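{- For every non-negative integer $n$ and every integer $i\ge 1$, $$f(n,i) = f(|n-2^{i-1}|,\, i-1) + f(n,\, i-1),$$ and moreover $f(0,i)=1$ for all $i \ge 0$.
   Context: For an integer $n$ and an integer $i\ge 0$, $f(n,i)$ denotes the number of binary signed-digit (BSD) representations of $n$ on $i$ bits, i.e. the number of tuples $(b_{i-1},\dots,b_0)\in\{1,0,-1\}^i$ with $n=\sum_{j=0}^{i-1} b_j 2^j$ (for $i=0$ the only tuple is the empty one, representing $0$). -}

module Defs where

open import Data.Nat using (ℕ; zero; suc)
open import Data.Integer using (ℤ; +_; -[1+_]; _+_; _*_)
open import Data.Vec using (Vec; []; _∷_)
open import Data.List using (List; []; _∷_; length; filter; map; concatMap)
open import Relation.Binary.PropositionalEquality using (_≡_)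
open import Data.Integer.Properties using (_≟_)

data Digit : Set where
  pos zer neg : Digit

digitVal : Digit → ℤ
digitVal pos = + 1
digitVal zer = + 0
digitVal neg = -[1+ 0 ]

-- Representation on i bits, vector listed as (b_{i-1}, ..., b_0);
-- value = sum_j b_j 2^j.
value : {i : ℕ} → Vec Digit i → ℤ
value {zero} [] = + 0
value {suc i} (b ∷ bs) = digitVal b * (+ (2 Data.Nat.^ i)) + value bs

allDigitVecs : (i : ℕ) → List (Vec Digit i)
allDigitVecs zero = [] ∷ []
allDigitVecs (suc i) =
  concatMap (λ b → map (b ∷_) (allDigitVecs i)) (pos ∷ zer ∷ neg ∷ [])

f : ℤ → ℕ → ℕ
f n i = length (filter (λ v → value v ≟ n) (allDigitVecs i))

-- Splitting on the leading digit b_{i-1} ∈ {1, 0, -1} gives the three-term recurrence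
-- f(m, i+1) = f(m - 2^i, i) + f(m, i) + f(m + 2^i, i), which is symmetric under
-- m ↦ -m; by induction f(-m, i) = f(m, i), and f(k, i) = 0 once k ≥ 2^i.  For n ≥ 0
-- the third term f(n + 2^i, i) therefore vanishes and the first equals
-- f(|n - 2^i|, i); for n = 0 only the middle term f(0, i) survives.
module Submission where

open import Defs
open import Data.Nat using (ℕ; suc; _^_)
open import Data.Integer using (ℤ; +_; ∣_∣; _-_)
open import Data.Product using (_×_)
open import Relation.Binary.PropositionalEquality using (_≡_)

open import Data.Nat as ℕ using (zero; _≤_; _∸_)
import Data.Nat.Properties as ℕ
open import Data.Integer as ℤ using (-_; -[1+_])
import Data.Integer.Properties as ℤ
open import Data.Integer.Properties using (_≟_)
open import Data.Integer.Tactic.RingSolver using (solve-∀)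
open import Data.List using (List; []; _∷_; length; filter; map; _++_)
import Data.List.Properties as List
open import Data.Vec using (Vec; _∷_)
open import Data.Product using (_,_)
open import Function.Bundles using (_⇔_; mk⇔; Equivalence)
open import Relation.Binary.PropositionalEquality
  using (refl; trans; cong; cong₂; subst; module ≡-Reasoning)
open import Relation.Nullary using (yes; no; contradiction)
open import Relation.Unary using (Pred; Decidable)
open import Algebra.Properties.CommutativeSemigroup ℕ.+-commutativeSemigroup
  using (x∙yz≈z∙yx)

module _ {a b p q} {A : Set a} {B : Set b} {P : Pred B p} {Q : Pred A q}
         (P? : Decidable P) (Q? : Decidable Q) where

  length-filter-map : (g : A → B) → (∀ x → P (g x) ⇔ Q x) →
    ∀ xs → length (filter P? (map g xs)) ≡ length (filter Q? xs)
  length-filter-map g P∘g⇔Q [] = refl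
  length-filter-map g P∘g⇔Q (x ∷ xs) with P? (g x) | Q? x
  ... | yes _  | yes _  = cong suc (length-filter-map g P∘g⇔Q xs)
  ... | yes px | no ¬qx = contradiction (Equivalence.to (P∘g⇔Q x) px) ¬qx
  ... | no ¬px | yes qx = contradiction (Equivalence.from (P∘g⇔Q x) qx) ¬px
  ... | no _   | no _   = length-filter-map g P∘g⇔Q xs

length-filter-++ : ∀ {a p} {A : Set a} {P : Pred A p} (P? : Decidable P) xs ys →
  length (filter P? (xs ++ ys)) ≡ length (filter P? xs) ℕ.+ length (filter P? ys)
length-filter-++ P? xs ys =
  trans (cong length (List.filter-++ P? xs ys)) (List.length-++ (filter P? xs))

m+n≡o⇔n≡o-m : ∀ m n o → m ℤ.+ n ≡ o ⇔ n ≡ o - m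
m+n≡o⇔n≡o-m m n o = mk⇔ (λ { refl → cancel m n }) (λ { refl → restore m o })
  where
  cancel : ∀ m n → n ≡ (m ℤ.+ n) - m
  cancel = solve-∀
  restore : ∀ m o → m ℤ.+ (o - m) ≡ o
  restore = solve-∀

count-cons : ∀ {i} (b : Digit) (m : ℤ) (vs : List (Vec Digit i)) →
  length (filter (λ v → value v ≟ m) (map (b ∷_) vs))
    ≡ length (filter (λ v → value v ≟ m - digitVal b ℤ.* + (2 ^ i)) vs)
count-cons b m = length-filter-map _ _ (b ∷_) (λ v → m+n≡o⇔n≡o-m _ (value v) m)

f-suc : ∀ m i → f m (suc i) ≡ f (m - + (2 ^ i)) i ℕ.+ (f m i ℕ.+ f (m ℤ.+ + (2 ^ i)) i)
f-suc m i = begin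
  f m (suc i)
    ≡⟨ length-filter-++ P? (map (pos ∷_) vs) _ ⟩
  count pos ℕ.+ length (filter P? (map (zer ∷_) vs ++ (map (neg ∷_) vs ++ [])))
    ≡⟨ cong (count pos ℕ.+_) (length-filter-++ P? (map (zer ∷_) vs) _) ⟩
  count pos ℕ.+ (count zer ℕ.+ length (filter P? (map (neg ∷_) vs ++ [])))
    ≡⟨ cong (λ k → count pos ℕ.+ (count zer ℕ.+ length (filter P? k))) (List.++-identityʳ (map (neg ∷_) vs)) ⟩
  count pos ℕ.+ (count zer ℕ.+ count neg)
    ≡⟨ cong₂ ℕ._+_ (trans (count-cons pos m vs) (cong (λ t → f t i) (minus-pos m c)))
         (cong₂ ℕ._+_ (trans (count-cons zer m vs) (cong (λ t → f t i) (minus-zer m c)))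
                      (trans (count-cons neg m vs) (cong (λ t → f t i) (minus-neg m c)))) ⟩
  f (m - c) i ℕ.+ (f m i ℕ.+ f (m ℤ.+ c) i) ∎
  where
  open ≡-Reasoning
  c = + (2 ^ i)
  vs = allDigitVecs i
  P? = λ (v : Vec Digit (suc i)) → value v ≟ m
  count : Digit → ℕ
  count b = length (filter P? (map (b ∷_) vs))
  minus-pos : ∀ m c → m - digitVal pos ℤ.* c ≡ m - c
  minus-pos = solve-∀
  minus-zer : ∀ m c → m - digitVal zer ℤ.* c ≡ m
  minus-zer = solve-∀
  minus-neg : ∀ m c → m - digitVal neg ℤ.* c ≡ m ℤ.+ c
  minus-neg = solve-∀

f-neg : ∀ i m → f (- m) i ≡ f m i
f-neg zero (+ zero) = refl
f-neg zero (+ suc k) = refl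
f-neg zero -[1+ k ] = refl
f-neg (suc i) m = begin
  f (- m) (suc i)
    ≡⟨ f-suc (- m) i ⟩
  f (- m - c) i ℕ.+ (f (- m) i ℕ.+ f (- m ℤ.+ c) i)
    ≡⟨ cong₂ ℕ._+_ (trans (cong (λ t → f t i) (neg-+ m c)) (f-neg i (m ℤ.+ c)))
         (cong₂ ℕ._+_ (f-neg i m) (trans (cong (λ t → f t i) (neg-- m c)) (f-neg i (m - c)))) ⟩
  f (m ℤ.+ c) i ℕ.+ (f m i ℕ.+ f (m - c) i)
    ≡⟨ x∙yz≈z∙yx (f (m ℤ.+ c) i) (f m i) (f (m - c) i) ⟩
  f (m - c) i ℕ.+ (f m i ℕ.+ f (m ℤ.+ c) i)
    ≡⟨ f-suc m i ⟨
  f m (suc i) ∎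
  where
  open ≡-Reasoning
  c = + (2 ^ i)
  neg-+ : ∀ m c → - m - c ≡ - (m ℤ.+ c)
  neg-+ = solve-∀
  neg-- : ∀ m c → - m ℤ.+ c ≡ - (m - c)
  neg-- = solve-∀

f-∣∣ : ∀ i m → f m i ≡ f (+ ∣ m ∣) i
f-∣∣ i (+ k) = refl
f-∣∣ i -[1+ k ] = f-neg i (+ suc k)

2^i≤k⇒f[k,i]≡0 : ∀ i k → 2 ^ i ≤ k → f (+ k) i ≡ 0
2^i≤k⇒f[k,i]≡0 zero (suc k) _ = refl
2^i≤k⇒f[k,i]≡0 (suc i) k 2c≤k = begin
  f (+ k) (suc i)
    ≡⟨ f-suc (+ k) i ⟩
  f (+ k - + c) i ℕ.+ (f (+ k) i ℕ.+ f (+ (k ℕ.+ c)) i)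
    ≡⟨ cong₂ ℕ._+_ (trans (cong (λ t → f t i) k-c≡k∸c) (2^i≤k⇒f[k,i]≡0 i (k ∸ c) c≤k∸c))
         (cong₂ ℕ._+_ (2^i≤k⇒f[k,i]≡0 i k c≤k) (2^i≤k⇒f[k,i]≡0 i (k ℕ.+ c) (ℕ.m≤n+m c k))) ⟩
  0 ∎
  where
  open ≡-Reasoning
  c = 2 ^ i
  c+c≤k : c ℕ.+ c ≤ k
  c+c≤k = subst (λ t → c ℕ.+ t ≤ k) (ℕ.+-identityʳ c) 2c≤k
  c≤k : c ≤ k
  c≤k = ℕ.m+n≤o⇒m≤o c c+c≤k
  c≤k∸c : c ≤ k ∸ c
  c≤k∸c = ℕ.m+n≤o⇒m≤o∸n c c+c≤k
  k-c≡k∸c : + k - + c ≡ + (k ∸ c)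
  k-c≡k∸c = trans (ℤ.m-n≡m⊖n k c) (ℤ.⊖-≥ c≤k)

theorem1 : ((n i : ℕ) → f (+ n) (suc i) ≡ f (+ ∣ + n - + (2 ^ i) ∣) i Data.Nat.+ f (+ n) i)
    × ((i : ℕ) → f (+ 0) i ≡ 1)
theorem1 = recurrence , f-zero
  where
  open ≡-Reasoning
  recurrence : (n i : ℕ) → f (+ n) (suc i) ≡ f (+ ∣ + n - + (2 ^ i) ∣) i Data.Nat.+ f (+ n) i
  recurrence n i = begin
    f (+ n) (suc i)
      ≡⟨ f-suc (+ n) i ⟩
    f (+ n - + (2 ^ i)) i ℕ.+ (f (+ n) i ℕ.+ f (+ (n ℕ.+ 2 ^ i)) i)
      ≡⟨ cong₂ ℕ._+_ (f-∣∣ i (+ n - + (2 ^ i)))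
           (cong (f (+ n) i ℕ.+_) (2^i≤k⇒f[k,i]≡0 i (n ℕ.+ 2 ^ i) (ℕ.m≤n+m _ n))) ⟩
    f (+ ∣ + n - + (2 ^ i) ∣) i ℕ.+ (f (+ n) i ℕ.+ 0)
      ≡⟨ cong (f (+ ∣ + n - + (2 ^ i) ∣) i ℕ.+_) (ℕ.+-identityʳ _) ⟩
    f (+ ∣ + n - + (2 ^ i) ∣) i ℕ.+ f (+ n) i ∎
  f-zero : (i : ℕ) → f (+ 0) i ≡ 1
  f-zero zero = refl
  f-zero (suc i) = begin
    f (+ 0) (suc i)
      ≡⟨ f-suc (+ 0) i ⟩
    f (+ 0 - + (2 ^ i)) i ℕ.+ (f (+ 0) i ℕ.+ f (+ (2 ^ i)) i)
      ≡⟨ cong₂ ℕ._+_ (trans (cong (λ t → f t i) (ℤ.+-identityˡ _))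
                       (trans (f-neg i (+ (2 ^ i))) (2^i≤k⇒f[k,i]≡0 i _ ℕ.≤-refl)))
           (cong₂ ℕ._+_ (f-zero i) (2^i≤k⇒f[k,i]≡0 i _ ℕ.≤-refl)) ⟩
    1 ∎
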